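{- Let $p$ be a prime, $q$ a power of $p$, and $m\ge1$. Let $L_m(q)$ be the bipartite graph whose vertex set is the disjoint union of a point set $\mathbb{F}_q^{m+1}$ and a line set $\mathbb{F}_q^{m+1}$, with a point $P=(p_1,\dots,p_{m+1})$ adjacent to a line $L=[l_1,\dots,l_{m+1}]$ if and only if $l_k+p_k=p_1^{\,p^{k-2}}\,l_1$ for all $k=2,\dots,m+1$. Then two distinct points $P,P'$ have a common neighbor if and only if $P-P'=(u,lu,lu^p,\dots,lu^{p^{m-1}})$ for some $u\in\mathbb{F}_q^*$ and $l\in\mathbb{F}_q$. Moreover, if $P-P'$ has this form with $u\in\mathbb{F}_q^*$, $l\in\mathbb{F}_q$, then $P$ and $P'$ have a unique common neighbor. -}

module Defs where

open import Level using (Level; _⊔_)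
open import Data.Nat as ℕ using (ℕ)
open import Data.Fin as Fin using (Fin; toℕ)
open import Data.Product using (Σ; ∃; _×_; _,_)
open import Relation.Nullary using (¬_)
open import Relation.Binary.PropositionalEquality as ≡ using (_≡_)
open import Algebra.Bundles using (CommutativeRing; Semiring)
open import Function.Bundles using (Inverse)
import Algebra.Definitions.RawSemiring as RS

record IsField {c ℓ : Level} (F : CommutativeRing c ℓ) : Set (c ⊔ ℓ) where
  open CommutativeRing F hiding (zero)
  open RS (Semiring.rawSemiring semiring) using (_^_)
  field
    1≉0 : ¬ (1# ≈ 0#)
    inv : ∀ x → ¬ (x ≈ 0#) → ∃ λ y → (x * y) ≈ 1#

HasOrder : {c ℓ : Level} → CommutativeRing c ℓ → ℕ → Set (c ⊔ ℓ)
HasOrder F q = Inverse (CommutativeRing.setoid F) (≡.setoid (Fin q))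

-- F has characteristic p (p · 1 = 0; used with p prime).
HasChar : {c ℓ : Level} → CommutativeRing c ℓ → ℕ → Set ℓ
HasChar F p = (p ·ℕ 1#) ≈ 0#
  where
  open CommutativeRing F
  open RS (Semiring.rawSemiring semiring) using () renaming (_×_ to _·ℕ_)

module LineGraph {c ℓ : Level} (F : CommutativeRing c ℓ) (p m : ℕ) where
  open CommutativeRing F hiding (zero)
  open RS (Semiring.rawSemiring semiring) using (_^_)

  -- Points and lines of L_m(q) are both elements of F^(m+1), indexed by
  -- Fin (ℕ.suc m); coordinate index i corresponds to subscript i+1.
  Point : Set c
  Point = Fin (ℕ.suc m) → Carrier

  Line : Set c
  Line = Fin (ℕ.suc m) → Carrier

  _≋_ : (Fin (ℕ.suc m) → Carrier) → (Fin (ℕ.suc m) → Carrier) → Set ℓ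
  P ≋ Q = ∀ i → P i ≈ Q i

  _⊖_ : (Fin (ℕ.suc m) → Carrier) → (Fin (ℕ.suc m) → Carrier) → Fin (ℕ.suc m) → Carrier
  (P ⊖ Q) i = P i - Q i

  -- P ~ L  iff  l_k + p_k = p_1^(p^(k-2)) l_1 for k = 2..m+1.
  -- Here k = 2 + i for i : Fin m, i.e. coordinate suc i, exponent p^i.
  Adjacent : Point → Line → Set ℓ
  Adjacent P L = ∀ (i : Fin m) →
    (L (Fin.suc i) + P (Fin.suc i)) ≈ ((P Fin.zero ^ (p ℕ.^ toℕ i)) * L Fin.zero)

  CommonNeighbour : Point → Point → Line → Set ℓ
  CommonNeighbour P P' L = Adjacent P L × Adjacent P' L

  special : Carrier → Carrier → Fin (ℕ.suc m) → Carrier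
  special u l Fin.zero = u
  special u l (Fin.suc i) = l * (u ^ (p ℕ.^ toℕ i))

  SpecialDifference : Point → Point → Set (c ⊔ ℓ)
  SpecialDifference P P' =
    ∃ λ u → ∃ λ l → ¬ (u ≈ 0#) × ((P ⊖ P') ≋ special u l)

-- A point P and the first coordinate l of a line L adjacent to it determine L, by
-- L_k = P₁^(p^(k-2)) l − P_k.  Subtracting the adjacency equations of two points of L
-- and using that x ↦ x^(p^i) is additive in characteristic p gives
-- P − P′ = (u, l u, l u^p, …) with u = P₁ − P′₁; conversely, for such a difference the
-- line through P with first coordinate l also passes through P′.  The second
-- coordinate of P − P′ is l u, so for u ≠ 0 it determines l, hence the common neighbour.

module Submission where

open import Data.Nat as ℕ using (ℕ; zero; suc; _!; _<_; _≤_; _∸_; z<s; s<s)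
open import Data.Nat.Properties using (_!*_!≢0; <⇒≤; <⇒≱; <-trans; n<1+n; ∸-monoʳ-<; n∸n≡0)
open import Data.Nat.Divisibility using (_∣_; _∤_; divides; ∣⇒≤; m∣m*n)
open import Data.Nat.DivMod using (m*[n/m]≡n)
open import Data.Nat.Primality using (Prime; euclidsLemma; prime⇒nonTrivial)
open import Data.Nat.Combinatorics using (_C_; nCk≡n!/k![n-k]!; k![n∸k]!∣n!; nCn≡1)
open import Data.Fin as Fin using (Fin; toℕ; fromℕ; inject₁)
open import Data.Fin.Properties using (toℕ-fromℕ; inject₁ℕ<)
open import Data.Product using (∃; _,_; proj₁; proj₂)
open import Data.Sum using (inj₁; inj₂; [_,_]′)
open import Data.Empty using (⊥-elim)
open import Data.Vec.Functional as Vector using (Vector; tail; init)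
open import Relation.Nullary using (¬_)
open import Relation.Binary.PropositionalEquality as ≡ using (_≡_)
open import Algebra.Bundles using (AbelianGroup; CommutativeSemiring; CommutativeRing; Ring)
import Algebra.Properties.Group as GroupProperties
import Algebra.Properties.Semiring.Exp as ExpProperties
import Relation.Binary.Reasoning.Setoid as SetoidReasoning

open import Defs

k![n∸k]!*nCk≡n! : ∀ {n k} → k ≤ n → k ! ℕ.* (n ∸ k) ! ℕ.* (n C k) ≡ n !
k![n∸k]!*nCk≡n! {n} {k} k≤n = ≡.trans
  (≡.cong (k ! ℕ.* (n ∸ k) ! ℕ.*_) (nCk≡n!/k![n-k]! k≤n))
  (m*[n/m]≡n {{k !* (n ∸ k) !≢0}} (k![n∸k]!∣n! k≤n))

prime∤m! : ∀ {p m} → Prime p → m < p → p ∤ m !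
prime∤m! {p} {zero} pr _ p∣1 = <⇒≱ (ℕ.nonTrivial⇒n>1 p {{prime⇒nonTrivial pr}}) (∣⇒≤ p∣1)
prime∤m! {p} {suc m} pr m<p p∣[1+m]! with euclidsLemma (suc m) (m !) pr p∣[1+m]!
... | inj₁ p∣1+m = <⇒≱ m<p (∣⇒≤ p∣1+m)
... | inj₂ p∣m! = prime∤m! pr (<-trans (n<1+n m) m<p) p∣m!

prime∣pCk : ∀ {p k} → Prime p → 0 < k → k < p → p ∣ p C k
prime∣pCk {suc n} {k} pr 0<k k<p
  with euclidsLemma (k ! ℕ.* (suc n ∸ k) !) (suc n C k) pr
         (≡.subst (suc n ∣_) (≡.sym (k![n∸k]!*nCk≡n! (<⇒≤ k<p))) (m∣m*n (n !)))
... | inj₂ p∣pCk = p∣pCk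
... | inj₁ p∣k![p∸k]! = ⊥-elim ([ prime∤m! pr k<p , prime∤m! pr (∸-monoʳ-< 0<k (<⇒≤ k<p)) ]′
                                   (euclidsLemma (k !) ((suc n ∸ k) !) pr p∣k![p∸k]!))

module FrobeniusProperties {c ℓ} (R : CommutativeSemiring c ℓ) where
  open CommutativeSemiring R
  open import Algebra.Properties.Semiring.Mult semiring
  open ExpProperties semiring
  open import Algebra.Properties.Monoid.Sum +-monoid
  open import Algebra.Properties.CommutativeSemiring.Binomial R
  open SetoidReasoning setoid

  char∣n⇒n×x≈0# : ∀ {p n} → p × 1# ≈ 0# → p ∣ n → ∀ x → n × x ≈ 0#
  char∣n⇒n×x≈0# {p} char (divides q ≡.refl) x = begin
    (q ℕ.* p) × x                ≈⟨ ×-assocˡ x q p ⟨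
    q × (p × x)                  ≈⟨ ×-congʳ q (×-congʳ p (*-identityˡ x)) ⟨
    q × (p × (1# * x))           ≈⟨ ×-congʳ q (×-assoc-* p 1# x) ⟨
    q × ((p × 1#) * x)           ≈⟨ ×-congʳ q (trans (*-congʳ char) (zeroˡ x)) ⟩
    q × 0#                       ≈⟨ sum-replicate q ⟨
    sum (Vector.replicate q 0#)  ≈⟨ sum-replicate-zero q ⟩
    0#                           ∎

  sum-≈0# : ∀ {n} (t : Vector Carrier n) → (∀ i → t i ≈ 0#) → sum t ≈ 0#
  sum-≈0# {n} t t≈0 = trans (sum-cong-≋ t≈0) (sum-replicate-zero n)

  module _ (x y : Carrier) where

    binomialTerm-first : ∀ n → binomialTerm x y n Fin.zero ≈ y ^ n
    binomialTerm-first n = trans (+-identityʳ _) (*-identityˡ _)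

    binomialTerm-last : ∀ n → binomialTerm x y n (fromℕ n) ≈ x ^ n
    binomialTerm-last n rewrite toℕ-fromℕ n | nCn≡1 n | n∸n≡0 n =
      trans (+-identityʳ _) (*-identityʳ _)

  -- The inner binomial coefficients p C k, 0 < k < p, vanish in characteristic p.
  frobenius : ∀ {p} → Prime p → p × 1# ≈ 0# → ∀ x y → (x + y) ^ p ≈ x ^ p + y ^ p
  frobenius {suc n} pr char x y = begin
    (x + y) ^ suc n                ≈⟨ theorem (suc n) x y ⟩
    t Fin.zero + sum (tail t)      ≈⟨ +-cong (binomialTerm-first x y (suc n)) (sum-init-last (tail t)) ⟩
    y ^ suc n + (sum (init (tail t)) + t (fromℕ (suc n)))
                                   ≈⟨ +-congˡ (+-cong (sum-≈0# _ inner≈0#) (binomialTerm-last x y (suc n))) ⟩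
    y ^ suc n + (0# + x ^ suc n)   ≈⟨ +-comm _ _ ⟩
    (0# + x ^ suc n) + y ^ suc n   ≈⟨ +-congʳ (+-identityˡ _) ⟩
    x ^ suc n + y ^ suc n          ∎
    where
    t = binomialTerm x y (suc n)
    inner≈0# : ∀ i → t (Fin.suc (inject₁ i)) ≈ 0#
    inner≈0# i = char∣n⇒n×x≈0# char (prime∣pCk pr z<s (s<s (inject₁ℕ< i))) _

  frobenius-^ : ∀ {p} → Prime p → p × 1# ≈ 0# →
                ∀ k x y → (x + y) ^ (p ℕ.^ k) ≈ x ^ (p ℕ.^ k) + y ^ (p ℕ.^ k)
  frobenius-^ pr char zero x y =
    trans (*-identityʳ _) (+-cong (sym (*-identityʳ x)) (sym (*-identityʳ y)))
  frobenius-^ {p} pr char (suc k) x y = begin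
    (x + y) ^ (p ℕ.* p ℕ.^ k)                  ≈⟨ ^-assocʳ (x + y) p (p ℕ.^ k) ⟨
    ((x + y) ^ p) ^ (p ℕ.^ k)                  ≈⟨ ^-congˡ (p ℕ.^ k) (frobenius pr char x y) ⟩
    (x ^ p + y ^ p) ^ (p ℕ.^ k)                ≈⟨ frobenius-^ pr char k (x ^ p) (y ^ p) ⟩
    (x ^ p) ^ (p ℕ.^ k) + (y ^ p) ^ (p ℕ.^ k)  ≈⟨ +-cong (^-assocʳ x p (p ℕ.^ k)) (^-assocʳ y p (p ℕ.^ k)) ⟩
    x ^ (p ℕ.* p ℕ.^ k) + y ^ (p ℕ.* p ℕ.^ k)  ∎

module FrobeniusRingProperties {c ℓ} (F : CommutativeRing c ℓ) where
  open CommutativeRing F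
  open FrobeniusProperties commutativeSemiring using (frobenius-^)
  open ExpProperties semiring using (_^_; ^-congˡ)
  open GroupProperties +-group using (x≈z//y; //-rightDividesˡ)
  open SetoidReasoning setoid

  frobenius-‿ : ∀ {p} → Prime p → HasChar F p →
                ∀ k x y → (x - y) ^ (p ℕ.^ k) ≈ x ^ (p ℕ.^ k) - y ^ (p ℕ.^ k)
  frobenius-‿ {p} pr char k x y = x≈z//y _ _ _ (sym (begin
    x ^ (p ℕ.^ k)                        ≈⟨ ^-congˡ (p ℕ.^ k) (//-rightDividesˡ y x) ⟨
    ((x - y) + y) ^ (p ℕ.^ k)            ≈⟨ frobenius-^ pr char k (x - y) y ⟩
    (x - y) ^ (p ℕ.^ k) + y ^ (p ℕ.^ k)  ∎))

module AbelianGroupProperties {c ℓ} (G : AbelianGroup c ℓ) where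
  open AbelianGroup G
  open GroupProperties group using (x≈z//y; //-rightDividesˡ)

  x-[x-y]≈y : ∀ x y → x - (x - y) ≈ y
  x-[x-y]≈y x y = sym (x≈z//y y (x - y) x (trans (comm y _) (//-rightDividesˡ y x)))

  x∙y-[x∙z]≈y-z : ∀ x y z → (x ∙ y) - (x ∙ z) ≈ y - z
  x∙y-[x∙z]≈y-z x y z = sym (x≈z//y (y - z) (x ∙ z) (x ∙ y) (begin
    (y - z) ∙ (x ∙ z)  ≈⟨ ∙-congˡ (comm x z) ⟩
    (y - z) ∙ (z ∙ x)  ≈⟨ assoc (y - z) z x ⟨
    ((y - z) ∙ z) ∙ x  ≈⟨ ∙-congʳ (//-rightDividesˡ z y) ⟩
    y ∙ x              ≈⟨ comm y x ⟩
    x ∙ y              ∎))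
    where open SetoidReasoning setoid

module FieldProperties {c ℓ} (F : CommutativeRing c ℓ) (isField : IsField F) where
  open CommutativeRing F
  open SetoidReasoning setoid

  *-cancelʳ-≉0 : ∀ {u x y} → ¬ (u ≈ 0#) → x * u ≈ y * u → x ≈ y
  *-cancelʳ-≉0 {u} {x} {y} u≉0 xu≈yu = begin
    x              ≈⟨ x≈[x*u]*v x ⟩
    (x * u) * v    ≈⟨ *-congʳ xu≈yu ⟩
    (y * u) * v    ≈⟨ x≈[x*u]*v y ⟨
    y              ∎
    where
    v = proj₁ (IsField.inv isField u u≉0)
    x≈[x*u]*v : ∀ x → x ≈ (x * u) * v
    x≈[x*u]*v x = begin
      x              ≈⟨ *-identityʳ x ⟨
      x * 1#         ≈⟨ *-congˡ (proj₂ (IsField.inv isField u u≉0)) ⟨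
      x * (u * v)    ≈⟨ *-assoc x u v ⟨
      (x * u) * v    ∎

module LineGraphProperties {c ℓ} (F : CommutativeRing c ℓ) (p m : ℕ) where
  open CommutativeRing F hiding (zero)
  open LineGraph F p m
  open ExpProperties semiring using (_^_; ^-congˡ)
  open GroupProperties +-group using (x≈z//y; //-rightDividesˡ; x∙y⁻¹≈ε⇒x≈y)
  open AbelianGroupProperties +-abelianGroup using (x-[x-y]≈y; x∙y-[x∙z]≈y-z)
  open import Algebra.Properties.RingWithoutOne (Ring.ringWithoutOne ring) using ([y-z]x≈yx-zx)
  open SetoidReasoning setoid

  infixr 8 _^p^_
  _^p^_ : Carrier → Fin m → Carrier
  x ^p^ i = x ^ (p ℕ.^ toℕ i)

  ^p^-congˡ : ∀ i {x y} → x ≈ y → x ^p^ i ≈ y ^p^ i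
  ^p^-congˡ i = ^-congˡ (p ℕ.^ toℕ i)

  line : Point → Carrier → Line
  line P l Fin.zero    = l
  line P l (Fin.suc i) = P Fin.zero ^p^ i * l - P (Fin.suc i)

  line-cong : ∀ P {l l′} → l ≈ l′ → line P l ≋ line P l′
  line-cong P l≈l′ Fin.zero    = l≈l′
  line-cong P l≈l′ (Fin.suc i) = +-congʳ (*-congˡ l≈l′)

  adjacent-line : ∀ P l → Adjacent P (line P l)
  adjacent-line P l i = //-rightDividesˡ (P (Fin.suc i)) _

  adjacent⇒≋line : ∀ P L → Adjacent P L → L ≋ line P (L Fin.zero)
  adjacent⇒≋line P L P~L Fin.zero    = refl
  adjacent⇒≋line P L P~L (Fin.suc i) = x≈z//y _ _ _ (P~L i)

  commonNeighbour⇒≋ : ∀ P P′ L → CommonNeighbour P P′ L → P Fin.zero ≈ P′ Fin.zero → P ≋ P′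
  commonNeighbour⇒≋ P P′ L (P~L , P′~L) P₀≈P′₀ = P≋P′
    where
    P≋P′ : P ≋ P′
    P≋P′ Fin.zero    = P₀≈P′₀
    P≋P′ (Fin.suc i) = begin
      P (Fin.suc i)                                  ≈⟨ x≈z//y _ _ _ (trans (+-comm _ _) (P~L i)) ⟩
      P Fin.zero ^p^ i * L Fin.zero - L (Fin.suc i)   ≈⟨ +-congʳ (*-congʳ (^p^-congˡ i P₀≈P′₀)) ⟩
      P′ Fin.zero ^p^ i * L Fin.zero - L (Fin.suc i)  ≈⟨ x≈z//y _ _ _ (trans (+-comm _ _) (P′~L i)) ⟨
      P′ (Fin.suc i)                                 ∎

  module _ (pr : Prime p) (char : HasChar F p) where
    open FrobeniusRingProperties F using (frobenius-‿)

    [x-y]^p^i*z≈x^p^i*z-y^p^i*z : ∀ i x y z → (x - y) ^p^ i * z ≈ x ^p^ i * z - y ^p^ i * z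
    [x-y]^p^i*z≈x^p^i*z-y^p^i*z i x y z =
      trans (*-congʳ (frobenius-‿ pr char (toℕ i) x y)) ([y-z]x≈yx-zx z _ _)

    commonNeighbour⇒special : ∀ P P′ L → CommonNeighbour P P′ L →
                              (P ⊖ P′) ≋ special (P Fin.zero - P′ Fin.zero) (L Fin.zero)
    commonNeighbour⇒special P P′ L cn Fin.zero = refl
    commonNeighbour⇒special P P′ L (P~L , P′~L) (Fin.suc i) = begin
      P (Fin.suc i) - P′ (Fin.suc i)                        ≈⟨ x∙y-[x∙z]≈y-z (L (Fin.suc i)) _ _ ⟨
      (L (Fin.suc i) + P (Fin.suc i)) - (L (Fin.suc i) + P′ (Fin.suc i))
                                                            ≈⟨ +-cong (P~L i) (-‿cong (P′~L i)) ⟩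
      P Fin.zero ^p^ i * l - P′ Fin.zero ^p^ i * l          ≈⟨ [x-y]^p^i*z≈x^p^i*z-y^p^i*z i _ _ l ⟨
      (P Fin.zero - P′ Fin.zero) ^p^ i * l                  ≈⟨ *-comm _ l ⟩
      l * (P Fin.zero - P′ Fin.zero) ^p^ i                  ∎
      where l = L Fin.zero

    special⇒adjacent : ∀ P P′ L u → Adjacent P L → (P ⊖ P′) ≋ special u (L Fin.zero) → Adjacent P′ L
    special⇒adjacent P P′ L u P~L D i = begin
      L (Fin.suc i) + P′ (Fin.suc i)                        ≈⟨ x-[x-y]≈y (L (Fin.suc i) + P (Fin.suc i)) _ ⟨
      (L (Fin.suc i) + P (Fin.suc i)) - ((L (Fin.suc i) + P (Fin.suc i)) - (L (Fin.suc i) + P′ (Fin.suc i)))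
                                                            ≈⟨ +-cong (P~L i) (-‿cong (x∙y-[x∙z]≈y-z _ _ _)) ⟩
      P Fin.zero ^p^ i * l - (P (Fin.suc i) - P′ (Fin.suc i))
                                                            ≈⟨ +-congˡ (-‿cong (D (Fin.suc i))) ⟩
      P Fin.zero ^p^ i * l - l * u ^p^ i                    ≈⟨ +-congˡ (-‿cong (*-comm l _)) ⟩
      P Fin.zero ^p^ i * l - u ^p^ i * l                    ≈⟨ +-congˡ (-‿cong (*-congʳ (^p^-congˡ i (D Fin.zero)))) ⟨
      P Fin.zero ^p^ i * l - (P Fin.zero - P′ Fin.zero) ^p^ i * l
                                                            ≈⟨ +-congˡ (-‿cong ([x-y]^p^i*z≈x^p^i*z-y^p^i*z i _ _ l)) ⟩
      P Fin.zero ^p^ i * l - (P Fin.zero ^p^ i * l - P′ Fin.zero ^p^ i * l)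
                                                            ≈⟨ x-[x-y]≈y _ _ ⟩
      P′ Fin.zero ^p^ i * l                                 ∎
      where l = L Fin.zero

    commonNeighbour⇒specialDifference : ∀ P P′ → ¬ (P ≋ P′) →
                                        ∃ (CommonNeighbour P P′) → SpecialDifference P P′
    commonNeighbour⇒specialDifference P P′ P≉P′ (L , cn) =
      P Fin.zero - P′ Fin.zero , L Fin.zero ,
      (λ u≈0 → P≉P′ (commonNeighbour⇒≋ P P′ L cn (x∙y⁻¹≈ε⇒x≈y _ _ u≈0))) ,
      commonNeighbour⇒special P P′ L cn

    specialDifference⇒commonNeighbour : ∀ P P′ → SpecialDifference P P′ → ∃ (CommonNeighbour P P′)
    specialDifference⇒commonNeighbour P P′ (u , l , _ , D) =
      line P l , adjacent-line P l , special⇒adjacent P P′ (line P l) u (adjacent-line P l) D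

module LineGraphUniqueness {c ℓ} (F : CommutativeRing c ℓ) (isField : IsField F)
                           {p} (pr : Prime p) (char : HasChar F p) (m : ℕ) where
  open CommutativeRing F hiding (zero)
  open LineGraph F p (suc m)
  open LineGraphProperties F p (suc m)
  open FieldProperties F isField using (*-cancelʳ-≉0)
  open SetoidReasoning setoid

  -- The first coordinate of L is read off the second coordinate l u of P − P′;
  -- this is where m ≥ 1 is used.
  commonNeighbour-unique : ∀ P P′ L u l → ¬ (u ≈ 0#) → (P ⊖ P′) ≋ special u l →
                           CommonNeighbour P P′ L → L ≋ line P l
  commonNeighbour-unique P P′ L u l u≉0 D cn@(P~L , _) i =
    trans (adjacent⇒≋line P L P~L i) (line-cong P L₀≈l i)
    where
    u^p^0≉0 : ¬ (u ^p^ Fin.zero ≈ 0#)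
    u^p^0≉0 u^p^0≈0 = u≉0 (trans (sym (*-identityʳ u)) u^p^0≈0)
    L₀≈l : L Fin.zero ≈ l
    L₀≈l = *-cancelʳ-≉0 u^p^0≉0 (begin
      L Fin.zero * u ^p^ Fin.zero                           ≈⟨ *-congˡ (^p^-congˡ Fin.zero (D Fin.zero)) ⟨
      L Fin.zero * (P Fin.zero - P′ Fin.zero) ^p^ Fin.zero  ≈⟨ commonNeighbour⇒special pr char P P′ L cn (Fin.suc Fin.zero) ⟨
      P (Fin.suc Fin.zero) - P′ (Fin.suc Fin.zero)          ≈⟨ D (Fin.suc Fin.zero) ⟩
      l * u ^p^ Fin.zero                                    ∎)

open import Level using (Level)
open import Data.Nat using (_^_; _≥_)
open import Data.Product using (_×_)
open import Function.Bundles using (_⇔_; mk⇔)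

lemma5p1 : ∀ {c ℓ : Level} (F : CommutativeRing c ℓ) (p e q m : ℕ) →
    Prime p → e ≥ 1 → q ≡ p ^ e →
    IsField F → HasOrder F q → HasChar F p → m ≥ 1 →
    let open LineGraph F p m in
    (∀ (P P' : Point) → ¬ (P ≋ P') →
      ((∃ λ L → CommonNeighbour P P' L) ⇔ SpecialDifference P P'))
    ×
    (∀ (P P' : Point) → SpecialDifference P P' →
      ∃ λ L → CommonNeighbour P P' L × (∀ L' → CommonNeighbour P P' L' → L' ≋ L))
lemma5p1 F p e q zero _ _ _ _ _ _ ()
lemma5p1 F p e q (suc m) pr _ _ isField _ char _ =
  (λ P P′ P≉P′ → mk⇔ (commonNeighbour⇒specialDifference pr char P P′ P≉P′)
                      (specialDifference⇒commonNeighbour pr char P P′)) ,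
  (λ P P′ sd@(u , l , u≉0 , D) →
     line P l , proj₂ (specialDifference⇒commonNeighbour pr char P P′ sd) ,
     λ L′ cn′ → commonNeighbour-unique P P′ L′ u l u≉0 D cn′)
  where
  open LineGraphProperties F p (suc m)
  open LineGraphUniqueness F isField pr char m
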